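{- There is a function $f$ such that, for all integers $k>2$ and $d>2$, the following holds: if $G$ is a graph of order at least $f(k,d)$ and $C$ is a Hamilton cycle of $G$, then there is a set $X\subseteq E(C)$ such that the parallel minor obtained from $G$ by contracting $X$ either has a vertex with at least $d$ neighbors or is isomorphic to $C_k$.
   Context: All graphs are finite and simple; the order of a graph is its number of vertices. Contracting a set $X$ of edges is always followed by deleting loops and all but one edge from each class of parallel edges, producing a simple graph, called a parallel minor. $C_k$ is the cycle on $k$ vertices. -}

module Defs where

open import Data.Nat using (ℕ; suc; _≤_; _<_)
open import Data.Nat.DivMod using (_mod_)
open import Data.Fin using (Fin; toℕ)
open import Data.Bool using (Bool; true)
open import Data.Product using (Σ; ∃; _×_; _,_)
open import Data.Sum using (_⊎_)
open import Relation.Nullary using (¬_; Dec)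
open import Relation.Binary.PropositionalEquality using (_≡_; _≢_)
open import Relation.Binary.Construct.Closure.Equivalence using (EqClosure)
open import Function.Definitions using (Injective; Bijective)
open import Function.Bundles using (_⇔_)

record Graph (n : ℕ) : Set₁ where
  field
    Adj    : Fin n → Fin n → Set
    adj?   : ∀ u v → Dec (Adj u v)
    sym    : ∀ {u v} → Adj u v → Adj v u
    irrefl : ∀ {u} → ¬ Adj u u
open Graph public

next : ∀ {n} → Fin (suc n) → Fin (suc n)
next {n} i = suc (toℕ i) mod (suc n)

-- Edge number i of the cycle
-- is the edge { σ i , σ (next i) }; as n ≥ 3 these n edges are distinct.
record HamCycle {n : ℕ} (G : Graph (suc n)) : Set where
  field
    order≥3 : 3 ≤ suc n
    σ       : Fin (suc n) → Fin (suc n)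
    σ-bij   : Bijective _≡_ _≡_ σ
    σ-adj   : ∀ i → Adj G (σ i) (σ (next i))
open HamCycle public

-- a set X ⊆ E(C) is given by its characteristic function on the edge indices
EdgeSet : ℕ → Set
EdgeSet n = Fin n → Bool

XEdge : ∀ {n} {G : Graph (suc n)} → HamCycle G → EdgeSet (suc n) →
        Fin (suc n) → Fin (suc n) → Set
XEdge C X u v = ∃ λ i → X i ≡ true × u ≡ σ C i × v ≡ σ C (next i)

-- The parallel minor G/X, presented (up to isomorphism) by a graph H on Fin m
-- together with a surjection π : V(G) → V(H) whose fibres are exactly the
-- connected components of the spanning subgraph (V(G), X), and where two
-- distinct vertices of H are adjacent iff some edge of G joins their fibres.
record IsContraction {n m : ℕ} {G : Graph (suc n)} (C : HamCycle G)
                     (X : EdgeSet (suc n)) (H : Graph m) : Set where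
  field
    π      : Fin (suc n) → Fin m
    π-surj : ∀ a → ∃ λ u → π u ≡ a
    π-fib  : ∀ u v → (π u ≡ π v) ⇔ EqClosure (XEdge C X) u v
    π-adj  : ∀ a b → Adj H a b ⇔
               (a ≢ b × ∃ λ u → ∃ λ v → π u ≡ a × π v ≡ b × Adj G u v)

HasDegreeAtLeast : ∀ {m} → ℕ → Graph m → Set
HasDegreeAtLeast {m} d H =
  ∃ λ (a : Fin m) → Σ (Fin d → Fin m) λ g → Injective _≡_ _≡_ g × (∀ j → Adj H a (g j))

CycleAdj : ∀ k → Fin k → Fin k → Set
CycleAdj (suc k) i j = j ≡ next i ⊎ i ≡ next j

IsoToCycle : ∀ {m} (k : ℕ) → Graph m → Set
IsoToCycle {m} k H = Σ (Fin m → Fin k) λ φ → Bijective _≡_ _≡_ φ ×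
                       (∀ a b → Adj H a b ⇔ CycleAdj k (φ a) (φ b))

-- Number the vertices 0, …, n along C; contracting edges of the path 0, …, n merges
-- intervals. If d vertices at or after a have neighbours before a, contracting [0, a)
-- gives a vertex of degree d. Otherwise one of d consecutive windows after a contains
-- no such vertex, and recursing inside it yields separators t 0 < … < t (d K) such that
-- an edge from before t i that reaches t (i + 1) reaches past all separators.
-- Symmetrically, with K = k − 2, either contracting from z = t (d K) on gives degree d,
-- or for some b no vertex between t b and t (b + K) has a neighbour from z on. Cutting
-- the path just before t b, …, t (b + K) then gives K + 2 intervals joined in a cycle:
-- consecutive ones along C, the first and last by the edge {n , 0}; any other edge would
-- have to start before t b and end after z.

module Submission where

open import Defs hiding (sym)
open import Data.Nat using (ℕ; zero; suc; _+_; _*_; _∸_; _≤_; _<_; z≤n; s≤s; z<s; s≤s⁻¹; _<?_; _≤?_; _⊓_; pred)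
open import Data.Nat.Properties
open import Data.Nat.DivMod using (_%_; m<n⇒m%n≡m; n%n≡0)
open import Data.Fin using (Fin; toℕ; fromℕ<) renaming (zero to fzero; suc to fsuc)
open import Data.Fin.Properties using (toℕ-injective; toℕ<n; fromℕ<-toℕ; toℕ-fromℕ<; any?) renaming (_≟_ to _≟ᶠ_)
open import Data.Vec.Functional using (_∷_)
open import Data.Bool using (true)
open import Data.Product using (Σ; ∃; _×_; _,_; proj₁; proj₂)
open import Data.Sum using (_⊎_; inj₁; inj₂; swap; map₂; [_,_]′)
open import Relation.Binary.Definitions using (Tri; tri<; tri≈; tri>)
open import Relation.Nullary using (¬_; Dec; yes; no; does; contradiction)
open import Relation.Nullary.Decidable using (_×-dec_; dec-true; map′)
open import Relation.Binary.PropositionalEquality using (_≡_; _≢_; refl; sym; trans; cong; subst; subst₂; module ≡-Reasoning)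
open import Function using (_∘_; id)
open import Function.Construct.Identity using (bijective)
open import Relation.Binary.Construct.Closure.Equivalence using (EqClosure; gfold; symmetric)
open import Relation.Binary.Construct.Closure.ReflexiveTransitive using (ε; _◅_; _◅◅_)
open import Relation.Binary.Construct.Closure.Symmetric using (fwd)
open import Function.Definitions using (Injective)
open import Function.Bundles using (_⇔_; mk⇔; Equivalence)

does-true : ∀ {P : Set} (P? : Dec P) → does P? ≡ true → P
does-true (yes p) _ = p

record AtLeast (d : ℕ) (P : ℕ → Set) : Set where
  constructor distinct
  field
    elem     : Fin d → ℕ
    elem-inj : Injective _≡_ _≡_ elem
    elem-P   : ∀ j → P (elem j)

AtLeast-map : ∀ {d} {P Q : ℕ → Set} → (∀ {y} → P y → Q y) → AtLeast d P → AtLeast d Q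
AtLeast-map f (distinct h h-inj h-P) = distinct h h-inj λ j → f (h-P j)

-- The windows [g (a + i ℓ), g (a + (i+1) ℓ)), i < dd, are scanned in turn; witnesses
-- from different windows are distinct because each lies below all later windows.
atLeast-or-gap : (Q : ℕ → Set) → (∀ y → Dec (Q y)) → (g : ℕ → ℕ) (ℓ : ℕ) → ∀ dd a →
  AtLeast dd (λ y → g a ≤ y × Q y)
  ⊎ (∃ λ b → a ≤ b × b + ℓ ≤ a + dd * ℓ × (∀ y → g b ≤ y → y < g (b + ℓ) → ¬ Q y))
atLeast-or-gap Q Q? g ℓ zero a = inj₁ (distinct (λ ()) (λ { {()} }) (λ ()))
atLeast-or-gap Q Q? g ℓ (suc dd) a
  with anyUpTo? (λ y → (g a ≤? y) ×-dec Q? y) (g (a + ℓ))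
... | no none = inj₂ (a , ≤-refl , +-monoʳ-≤ a (m≤m+n ℓ (dd * ℓ)) ,
                      λ y ga≤y y< qy → none (y , y< , ga≤y , qy))
... | yes (y , y< , ga≤y , qy) with atLeast-or-gap Q Q? g ℓ dd (a + ℓ)
...   | inj₂ (b , a+ℓ≤b , bound , gap) =
        inj₂ (b , ≤-trans (m≤m+n a ℓ) a+ℓ≤b , subst (b + ℓ ≤_) (+-assoc a ℓ (dd * ℓ)) bound , gap)
...   | inj₁ (distinct h h-inj h-Q) = inj₁ (distinct (y ∷ h) y∷h-inj y∷h-Q)
  where
  y<h : ∀ j → y < h j
  y<h j = <-≤-trans y< (proj₁ (h-Q j))
  y∷h-inj : Injective _≡_ _≡_ (y ∷ h)
  y∷h-inj {fzero}  {fzero}  _ = refl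
  y∷h-inj {fzero}  {fsuc j} e = contradiction e (<⇒≢ (y<h j))
  y∷h-inj {fsuc i} {fzero}  e = contradiction (sym e) (<⇒≢ (y<h i))
  y∷h-inj {fsuc i} {fsuc j} e = cong fsuc (h-inj e)
  y∷h-Q : ∀ j → g a ≤ (y ∷ h) j × Q ((y ∷ h) j)
  y∷h-Q fzero    = ga≤y , qy
  y∷h-Q (fsuc j) = ≤-trans (<⇒≤ (≤-<-trans ga≤y y<)) (proj₁ (h-Q j)) , proj₂ (h-Q j)

steps-mono : ∀ {f : ℕ → ℕ} {m} → (∀ {j} → j < m → f j < f (suc j)) →
             ∀ {i j} → i ≤ j → j ≤ m → f i ≤ f j
steps-mono step {j = zero}  z≤n _ = ≤-refl
steps-mono step {j = suc j} i≤1+j 1+j≤m with m≤n⇒m<n∨m≡n i≤1+j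
... | inj₂ refl = ≤-refl
... | inj₁ (s≤s i≤j) = ≤-trans (steps-mono step i≤j (<⇒≤ 1+j≤m)) (<⇒≤ (step 1+j≤m))

module Count {P : ℕ → Set} (P? : ∀ j → Dec (P j)) where

  count : ℕ → ℕ
  count zero = 0
  count (suc m) with P? m
  ... | yes _ = suc (count m)
  ... | no _  = count m

  count≤ : ∀ m → count m ≤ m
  count≤ zero = z≤n
  count≤ (suc m) with P? m
  ... | yes _ = s≤s (count≤ m)
  ... | no _  = m≤n⇒m≤1+n (count≤ m)

  DownClosedBelow : ℕ → Set
  DownClosedBelow m = ∀ {j} → suc j < m → P (suc j) → P j

  down-all : ∀ {m} → DownClosedBelow (suc m) → P m → ∀ {j} → j ≤ m → P j
  down-all {zero}  _    pm z≤n = pm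
  down-all {suc m} down pm j≤1+m with m≤n⇒m<n∨m≡n j≤1+m
  ... | inj₂ refl = pm
  ... | inj₁ j<1+m = down-all (λ lt → down (m<n⇒m<1+n lt)) (down ≤-refl pm) (s≤s⁻¹ j<1+m)

  count-all : ∀ {m} → (∀ {j} → j < m → P j) → count m ≡ m
  count-all {zero}  _   = refl
  count-all {suc m} all with P? m
  ... | yes _  = cong suc (count-all (λ lt → all (m<n⇒m<1+n lt)))
  ... | no ¬pm = contradiction (all ≤-refl) ¬pm

  count-threshold : ∀ m → DownClosedBelow m → ∀ {r} → r < m → r < count m ⇔ P r
  count-threshold (suc m) down {r} r<1+m with P? m
  ... | yes pm = mk⇔ (λ _ → down-all down pm (s≤s⁻¹ r<1+m))
                     (λ _ → subst (r <_) (cong suc (sym (count-all (λ lt → down-all down pm (<⇒≤ lt))))) r<1+m)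
  ... | no ¬pm with m<1+n⇒m<n∨m≡n r<1+m
  ...   | inj₁ r<m  = count-threshold m (λ lt → down (m<n⇒m<1+n lt)) r<m
  ...   | inj₂ refl = mk⇔ (λ lt → contradiction (<-≤-trans lt (count≤ r)) (n≮n r))
                          (λ pr → contradiction pr ¬pm)

toℕ-next : ∀ {m} (i : Fin (suc m)) → suc (toℕ i) < suc m → toℕ (next i) ≡ suc (toℕ i)
toℕ-next i lt = trans (toℕ-fromℕ< _) (m<n⇒m%n≡m lt)

toℕ-next-last : ∀ {m} (i : Fin (suc m)) → toℕ i ≡ m → toℕ (next i) ≡ 0
toℕ-next-last {m} i eq = trans (toℕ-fromℕ< _) (trans (cong (λ x → suc x % suc m) eq) (n%n≡0 (suc m)))

toℕ-next-cases : ∀ {m} (i : Fin (suc m)) →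
                 toℕ (next i) ≡ suc (toℕ i) ⊎ (toℕ i ≡ m × toℕ (next i) ≡ 0)
toℕ-next-cases i with m<1+n⇒m<n∨m≡n (toℕ<n i)
... | inj₁ lt = inj₁ (toℕ-next i (s≤s lt))
... | inj₂ eq = inj₂ (eq , toℕ-next-last i eq)

CycleEdge< : ℕ → ℕ → ℕ → Set
CycleEdge< K x y = y ≡ suc x ⊎ (x ≡ 0 × y ≡ suc K)

cycleAdj⇔ : ∀ {K} (a b : Fin (suc (suc K))) →
            CycleAdj (suc (suc K)) a b ⇔ (CycleEdge< K (toℕ a) (toℕ b) ⊎ CycleEdge< K (toℕ b) (toℕ a))
cycleAdj⇔ {K} a b = mk⇔ to from
  where
  step : ∀ x y → CycleEdge< K (toℕ x) (toℕ y) → y ≡ next x ⊎ x ≡ next y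
  step x y (inj₁ e) = inj₁ (toℕ-injective (trans e (sym (toℕ-next x (subst (_< suc (suc K)) e (toℕ<n y))))))
  step x y (inj₂ (x≡0 , y≡K+1)) = inj₂ (toℕ-injective (trans x≡0 (sym (toℕ-next-last y y≡K+1))))
  successor : ∀ x y → y ≡ next x → CycleEdge< K (toℕ x) (toℕ y) ⊎ CycleEdge< K (toℕ y) (toℕ x)
  successor x y refl with toℕ-next-cases x
  ... | inj₁ e = inj₁ (inj₁ e)
  ... | inj₂ (x≡K+1 , e) = inj₂ (inj₂ (e , x≡K+1))
  to : CycleAdj (suc (suc K)) a b → CycleEdge< K (toℕ a) (toℕ b) ⊎ CycleEdge< K (toℕ b) (toℕ a)
  to (inj₁ b≡a⁺) = successor a b b≡a⁺
  to (inj₂ a≡b⁺) = swap (successor b a a≡b⁺)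
  from : CycleEdge< K (toℕ a) (toℕ b) ⊎ CycleEdge< K (toℕ b) (toℕ a) → CycleAdj (suc (suc K)) a b
  from (inj₁ e) = step a b e
  from (inj₂ e) = swap (step b a e)

-- room for one separator followed by d windows, each with room for s − 1 separators
separationLength : ℕ → ℕ → ℕ
separationLength d zero    = 0
separationLength d (suc s) = suc (d * separationLength d s)

module AlongCycle {n : ℕ} (G : Graph (suc n)) (C : HamCycle G) where

  N : ℕ
  N = suc n

  Contraction : (∀ m → Graph m → Set) → Set₁
  Contraction P = ∃ λ (X : EdgeSet N) → ∃ λ (m : ℕ) → ∃ λ (H : Graph m) → IsContraction C X H × P m H

  contraction-map : ∀ {P Q : ∀ m → Graph m → Set} →
                    (∀ {m} {H : Graph m} → P m H → Q m H) → Contraction P → Contraction Q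
  contraction-map f (X , m , H , X-H , pH) = X , m , H , X-H , f pH

  σ⁻¹ : Fin N → Fin N
  σ⁻¹ y = proj₁ (proj₂ (σ-bij C) y)

  σ∘σ⁻¹ : ∀ y → σ C (σ⁻¹ y) ≡ y
  σ∘σ⁻¹ y = proj₂ (proj₂ (σ-bij C) y) refl

  σ⁻¹∘σ : ∀ x → σ⁻¹ (σ C x) ≡ x
  σ⁻¹∘σ x = proj₁ (σ-bij C) (σ∘σ⁻¹ (σ C x))

  position : Fin N → ℕ
  position u = toℕ (σ⁻¹ u)

  position<N : ∀ u → position u < N
  position<N u = toℕ<n (σ⁻¹ u)

  vertexAt : ∀ p → p < N → Fin N
  vertexAt p p<N = σ C (fromℕ< p<N)

  vertexAt-position : ∀ u → vertexAt (position u) (position<N u) ≡ u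
  vertexAt-position u = trans (cong (σ C) (fromℕ<-toℕ (σ⁻¹ u) (position<N u))) (σ∘σ⁻¹ u)

  position-vertexAt : ∀ p (p<N : p < N) → position (vertexAt p p<N) ≡ p
  position-vertexAt p p<N = trans (cong toℕ (σ⁻¹∘σ (fromℕ< p<N))) (toℕ-fromℕ< p<N)

  infix 4 _~_
  _~_ : ℕ → ℕ → Set
  p ~ q = Σ (p < N) λ p<N → Σ (q < N) λ q<N → Adj G (vertexAt p p<N) (vertexAt q q<N)

  _~?_ : ∀ p q → Dec (p ~ q)
  p ~? q with p <? N | q <? N
  ... | no p≮N | _ = no λ (p<N , _) → p≮N p<N
  ... | yes p<N | no q≮N = no λ (_ , q<N , _) → q≮N q<N
  ... | yes p<N | yes q<N with adj? G (vertexAt p p<N) (vertexAt q q<N)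
  ...   | yes e = yes (p<N , q<N , e)
  ...   | no ¬e = no λ (_ , _ , e) → ¬e e

  ~-sym : ∀ {p q} → p ~ q → q ~ p
  ~-sym (p<N , q<N , e) = q<N , p<N , Graph.sym G e

  ~-irrefl : ∀ {p q} → p ~ q → p ≢ q
  ~-irrefl (_ , _ , e) refl = irrefl G e

  ~-<N : ∀ {p q} → p ~ q → q < N
  ~-<N (_ , q<N , _) = q<N

  Adj⇒~ : ∀ {u v} → Adj G u v → position u ~ position v
  Adj⇒~ {u} {v} e = position<N u , position<N v ,
    subst₂ (Adj G) (sym (vertexAt-position u)) (sym (vertexAt-position v)) e

  next-fromℕ< : ∀ {p} (p<N : p < N) (1+p<N : suc p < N) → next (fromℕ< p<N) ≡ fromℕ< 1+p<N
  next-fromℕ< {p} p<N 1+p<N = toℕ-injective (begin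
      toℕ (next (fromℕ< p<N))  ≡⟨ toℕ-next _ (subst (λ x → suc x < N) (sym (toℕ-fromℕ< p<N)) 1+p<N) ⟩
      suc (toℕ (fromℕ< p<N))   ≡⟨ cong suc (toℕ-fromℕ< p<N) ⟩
      suc p                    ≡⟨ sym (toℕ-fromℕ< 1+p<N) ⟩
      toℕ (fromℕ< 1+p<N)       ∎)
    where open ≡-Reasoning

  path-edge : ∀ {p} → suc p < N → p ~ suc p
  path-edge {p} 1+p<N = p<N , 1+p<N ,
    subst (λ w → Adj G (vertexAt p p<N) (σ C w)) (next-fromℕ< p<N 1+p<N) (σ-adj C (fromℕ< p<N))
    where
    p<N : p < N
    p<N = <-trans (n<1+n p) 1+p<N

  wrap-edge : 0 ~ n
  wrap-edge = ~-sym (≤-refl , s≤s z≤n ,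
    subst (λ w → Adj G (vertexAt n ≤-refl) (σ C w)) next-last≡ (σ-adj C (fromℕ< ≤-refl)))
    where
    next-last≡ : next (fromℕ< (≤-refl {N})) ≡ fromℕ< (s≤s z≤n)
    next-last≡ = toℕ-injective (toℕ-next-last _ (toℕ-fromℕ< _))

  -- Contracting path edges of C (never the edge from position n back to 0) merges
  -- intervals of positions; the classes are given by a monotone labelling onto [0, m).
  module IntervalContraction (lab : ℕ → ℕ) (m : ℕ)
                             (lab<m : ∀ {p} → p < N → lab p < m)
                             (lab-mono : ∀ {p q} → p ≤ q → lab p ≤ lab q)
                             (lab-onto : ∀ {r} → r < m → ∃ λ p → p < N × lab p ≡ r) where

    π : Fin N → Fin m
    π u = fromℕ< (lab<m (position<N u))

    toℕ-π : ∀ u → toℕ (π u) ≡ lab (position u)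
    toℕ-π u = toℕ-fromℕ< _

    π-vertexAt : ∀ {p} (p<N : p < N) {a : Fin m} → lab p ≡ toℕ a → π (vertexAt p p<N) ≡ a
    π-vertexAt {p} p<N e = toℕ-injective (trans (toℕ-π _) (trans (cong lab (position-vertexAt p p<N)) e))

    Merged : Fin N → Set
    Merged i = suc (toℕ i) < N × lab (suc (toℕ i)) ≡ lab (toℕ i)

    Merged? : ∀ i → Dec (Merged i)
    Merged? i = (suc (toℕ i) <? N) ×-dec (lab (suc (toℕ i)) ≟ lab (toℕ i))

    X : EdgeSet N
    X i = does (Merged? i)

    H-Adj : Fin m → Fin m → Set
    H-Adj a b = a ≢ b × ∃ λ u → ∃ λ v → π u ≡ a × π v ≡ b × Adj G u v

    H : Graph m
    H = record
      { Adj    = H-Adj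
      ; adj?   = H-adj?
      ; sym    = λ (a≢b , u , v , πu , πv , e) → (λ b≡a → a≢b (sym b≡a)) , v , u , πv , πu , Graph.sym G e
      ; irrefl = λ (a≢a , _) → a≢a refl
      }
      where
      H-adj? : ∀ a b → Dec (H-Adj a b)
      H-adj? a b with a ≟ᶠ b
      ... | yes a≡b = no λ (a≢b , _) → a≢b a≡b
      ... | no a≢b with any? (λ u → any? (λ v → (π u ≟ᶠ a) ×-dec ((π v ≟ᶠ b) ×-dec adj? G u v)))
      ...   | yes edge = yes (a≢b , edge)
      ...   | no ¬edge = no λ (_ , edge) → ¬edge edge

    XE : Fin N → Fin N → Set
    XE = XEdge C X

    XEdge⇒π≡ : ∀ {u v} → XE u v → π u ≡ π v
    XEdge⇒π≡ (i , Xi , refl , refl) = toℕ-injective (begin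
        toℕ (π (σ C i))               ≡⟨ toℕ-π _ ⟩
        lab (position (σ C i))        ≡⟨ cong (lab ∘ toℕ) (σ⁻¹∘σ i) ⟩
        lab (toℕ i)                   ≡⟨ sym (proj₂ merged) ⟩
        lab (suc (toℕ i))             ≡⟨ cong lab (sym (toℕ-next i (proj₁ merged))) ⟩
        lab (toℕ (next i))            ≡⟨ cong (lab ∘ toℕ) (sym (σ⁻¹∘σ (next i))) ⟩
        lab (position (σ C (next i))) ≡⟨ sym (toℕ-π _) ⟩
        toℕ (π (σ C (next i)))        ∎)
      where
      open ≡-Reasoning
      merged : Merged i
      merged = does-true (Merged? i) Xi

    equal-labels⇒XPath : ∀ p q → p ≤ q → (p<N : p < N) (q<N : q < N) → lab p ≡ lab q →
                         EqClosure XE (vertexAt p p<N) (vertexAt q q<N)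
    equal-labels⇒XPath p zero z≤n _ _ _ = ε
    equal-labels⇒XPath p (suc q) p≤1+q p<N 1+q<N lp≡l1+q with m≤n⇒m<n∨m≡n p≤1+q
    ... | inj₂ refl = ε
    ... | inj₁ (s≤s p≤q) = equal-labels⇒XPath p q p≤q p<N q<N lp≡lq ◅◅ (fwd contracted ◅ ε)
      where
      q<N : q < N
      q<N = <-trans (n<1+n q) 1+q<N
      lp≡lq : lab p ≡ lab q
      lp≡lq = ≤-antisym (lab-mono p≤q) (subst (lab q ≤_) (sym lp≡l1+q) (lab-mono (n≤1+n q)))
      i : Fin N
      i = fromℕ< q<N
      merged : Merged i
      merged = subst (λ x → suc x < N × lab (suc x) ≡ lab x) (sym (toℕ-fromℕ< q<N))
                     (1+q<N , trans (sym lp≡l1+q) lp≡lq)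
      contracted : XE (vertexAt q q<N) (vertexAt (suc q) 1+q<N)
      contracted = i , dec-true (Merged? i) merged ,
                   refl , cong (σ C) (sym (next-fromℕ< q<N 1+q<N))

    π-fibres : ∀ u v → (π u ≡ π v) ⇔ EqClosure XE u v
    π-fibres u v = mk⇔ to (gfold {S = _≡_} (record { refl = refl ; sym = sym ; trans = trans }) π XEdge⇒π≡)
      where
      same-label : π u ≡ π v → lab (position u) ≡ lab (position v)
      same-label e = trans (sym (toℕ-π u)) (trans (cong toℕ e) (toℕ-π v))
      to : π u ≡ π v → EqClosure XE u v
      to e with ≤-total (position u) (position v)
      ... | inj₁ le = subst₂ (EqClosure XE) (vertexAt-position u) (vertexAt-position v)
                        (equal-labels⇒XPath _ _ le (position<N u) (position<N v) (same-label e))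
      ... | inj₂ le = symmetric XE (subst₂ (EqClosure XE) (vertexAt-position v) (vertexAt-position u)
                        (equal-labels⇒XPath _ _ le (position<N v) (position<N u) (sym (same-label e))))

    isContraction : IsContraction C X H
    isContraction = record
      { π      = π
      ; π-surj = λ a → let (p , p<N , lp) = lab-onto (toℕ<n a) in vertexAt p p<N , π-vertexAt p<N lp
      ; π-fib  = π-fibres
      ; π-adj  = λ a b → mk⇔ (λ h → h) (λ h → h)
      }

    ~⇒H-Adj : ∀ {p q} → p ~ q → {a b : Fin m} → lab p ≡ toℕ a → lab q ≡ toℕ b → a ≢ b → H-Adj a b
    ~⇒H-Adj (p<N , q<N , e) lp lq a≢b = a≢b , _ , _ , π-vertexAt p<N lp , π-vertexAt q<N lq , e

    H-Adj⇒~ : ∀ {a b} → H-Adj a b → ∃ λ p → ∃ λ q → p ~ q × lab p ≡ toℕ a × lab q ≡ toℕ b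
    H-Adj⇒~ (_ , u , v , refl , refl , e) = position u , position v , Adj⇒~ e , sym (toℕ-π u) , sym (toℕ-π v)

  PrefixNeighbour : ℕ → ℕ → Set
  PrefixNeighbour q y = q ≤ y × ∃ λ u → u < q × u ~ y

  PrefixNeighbour? : ∀ q y → Dec (PrefixNeighbour q y)
  PrefixNeighbour? q y = (q ≤? y) ×-dec anyUpTo? (λ u → u ~? y) q

  SuffixNeighbour : ℕ → ℕ → Set
  SuffixNeighbour z y = y < z × ∃ λ v → z ≤ v × y ~ v

  SuffixNeighbour? : ∀ z y → Dec (SuffixNeighbour z y)
  SuffixNeighbour? z y = (y <? z) ×-dec map′ (λ (v , _ , z≤v , e) → v , z≤v , e)
                                             (λ (v , z≤v , e) → v , ~-<N e , z≤v , e)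
                                             (anyUpTo? (λ v → (z ≤? v) ×-dec (y ~? v)) N)

  -- contract the positions before q to a single vertex
  prefix-star : ∀ {d q} → 1 ≤ q → q ≤ N → AtLeast d (PrefixNeighbour q) →
                Contraction (λ _ → HasDegreeAtLeast d)
  prefix-star {d} {q} 1≤q q≤N (distinct h h-inj h-nb) =
    Star.X , suc N ∸ q , Star.H , Star.isContraction , hub , g , g-inj , g-adj
    where
    lab : ℕ → ℕ
    lab p = suc p ∸ q
    lab<m : ∀ {p} → p < N → lab p < suc N ∸ q
    lab<m {p} p<N with q ≤? suc p
    ... | yes q≤1+p = ∸-monoˡ-< (s≤s p<N) q≤1+p
    ... | no q≰1+p  = subst (_< suc N ∸ q) (sym (m≤n⇒m∸n≡0 (<⇒≤ (≰⇒> q≰1+p))))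
                            (m<n⇒0<n∸m (s≤s q≤N))
    lab-onto : ∀ {r} → r < suc N ∸ q → ∃ λ p → p < N × lab p ≡ r
    lab-onto {zero}  _ = 0 , s≤s z≤n , m≤n⇒m∸n≡0 1≤q
    lab-onto {suc r} r<m = r + q , s≤s⁻¹ (m≤o∸n⇒m+n≤o (suc (suc r)) (m≤n⇒m≤1+n q≤N) r<m) ,
                           m+n∸n≡m (suc r) q
    module Star = IntervalContraction lab (suc N ∸ q) lab<m (λ p≤p′ → ∸-monoˡ-≤ q (s≤s p≤p′)) lab-onto
    g : Fin d → Fin (suc N ∸ q)
    g j = let (_ , _ , _ , u~hj) = h-nb j in fromℕ< (lab<m (~-<N u~hj))
    lab-h : ∀ j → toℕ (g j) ≡ suc (h j ∸ q)
    lab-h j = trans (toℕ-fromℕ< _) (+-∸-assoc 1 (proj₁ (h-nb j)))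
    g-inj : Injective _≡_ _≡_ g
    g-inj {i} {j} e = h-inj (begin
      h i                 ≡⟨ sym (m∸n+n≡m (proj₁ (h-nb i))) ⟩
      h i ∸ q + q         ≡⟨ cong (λ x → pred x + q) (trans (sym (lab-h i)) (trans (cong toℕ e) (lab-h j))) ⟩
      h j ∸ q + q         ≡⟨ m∸n+n≡m (proj₁ (h-nb j)) ⟩
      h j                 ∎)
      where open ≡-Reasoning
    hub : Fin (suc N ∸ q)
    hub = fromℕ< (m<n⇒0<n∸m (s≤s q≤N))
    g-adj : ∀ j → Adj Star.H hub (g j)
    g-adj j with h-nb j
    ... | _ , u , u<q , e =
          Star.~⇒H-Adj e (trans (m≤n⇒m∸n≡0 u<q) (sym (toℕ-fromℕ< _))) (sym (toℕ-fromℕ< _))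
            λ hub≡gj → 0≢1+n (trans (sym (toℕ-fromℕ< _)) (trans (cong toℕ hub≡gj) (lab-h j)))

  -- contract the positions from z on to a single vertex
  suffix-star : ∀ {d z} → z < N → AtLeast d (SuffixNeighbour z) → Contraction (λ _ → HasDegreeAtLeast d)
  suffix-star {d} {z} z<N (distinct h h-inj h-nb) =
    Star.X , suc z , Star.H , Star.isContraction , hub , g , g-inj , g-adj
    where
    module Star = IntervalContraction (_⊓ z) (suc z) (λ {p} _ → s≤s (m⊓n≤n p z)) (⊓-monoˡ-≤ z)
                    (λ {r} r<1+z → r , ≤-<-trans (s≤s⁻¹ r<1+z) z<N , m≤n⇒m⊓n≡m (s≤s⁻¹ r<1+z))
    hub : Fin (suc z)
    hub = fromℕ< (n<1+n z)
    g : Fin d → Fin (suc z)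
    g j = fromℕ< (m<n⇒m<1+n (proj₁ (h-nb j)))
    g-inj : Injective _≡_ _≡_ g
    g-inj e = h-inj (trans (sym (toℕ-fromℕ< _)) (trans (cong toℕ e) (toℕ-fromℕ< _)))
    g-adj : ∀ j → Adj Star.H hub (g j)
    g-adj j with h-nb j
    ... | hj<z , v , z≤v , e = Star.~⇒H-Adj (~-sym e)
            (trans (m≥n⇒m⊓n≡n z≤v) (sym (toℕ-fromℕ< _)))
            (trans (m≤n⇒m⊓n≡m (<⇒≤ hj<z)) (sym (toℕ-fromℕ< _)))
            λ hub≡gj → <⇒≢ hj<z (sym (trans (sym (toℕ-fromℕ< _)) (trans (cong toℕ hub≡gj) (toℕ-fromℕ< _))))

  -- the intervals [0, T 0), [T 0, T 1), …, [T K, n] become the vertices of C_(K+2)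
  cycle-contraction : ∀ K (T : ℕ → ℕ) → (∀ {j} → j < K → T j < T (suc j)) → 0 < T 0 → T K < N →
    (∀ {j u v} → j < K → u < T j → u ~ v → T (suc j) ≤ v → u < T 0 × T K ≤ v) →
    Contraction (λ _ → IsoToCycle (suc (suc K)))
  cycle-contraction K T T-step 0<T0 TK<N long-edge =
    Cyc.X , suc (suc K) , Cyc.H , Cyc.isContraction , id , bijective _≡_ ,
    λ a b → mk⇔ (H-Adj⇒cycle a b) (cycle⇒H-Adj a b)
    where
    T-mono : ∀ {i j} → i ≤ j → j ≤ K → T i ≤ T j
    T-mono = steps-mono T-step

    lab : ℕ → ℕ
    lab p = Count.count (λ j → T j ≤? p) (suc K)

    lab≤ : ∀ p → lab p ≤ suc K
    lab≤ p = Count.count≤ (λ j → T j ≤? p) (suc K)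

    lab-threshold : ∀ {r p} → r ≤ K → r < lab p ⇔ T r ≤ p
    lab-threshold {p = p} r≤K = Count.count-threshold (λ j → T j ≤? p) (suc K)
      (λ 1+j<1+K T1+j≤p → ≤-trans (<⇒≤ (T-step (s≤s⁻¹ 1+j<1+K))) T1+j≤p) (s≤s r≤K)

    below-lab : ∀ {r p} → r < lab p → T r ≤ p
    below-lab {r} {p} r<lab = Equivalence.to (lab-threshold (s≤s⁻¹ (<-≤-trans r<lab (lab≤ p)))) r<lab

    before-lab : ∀ {p} → lab p ≤ K → p < T (lab p)
    before-lab lab≤K = ≰⇒> λ T≤p → <-irrefl refl (Equivalence.from (lab-threshold lab≤K) T≤p)

    lab-exact : ∀ {p r} → r ≤ suc K → (∀ {j} → j < r → T j ≤ p) → (r ≤ K → p < T r) → lab p ≡ r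
    lab-exact {p} {r} r≤1+K before after = ≤-antisym upper (lower r r≤1+K before)
      where
      upper : lab p ≤ r
      upper = ≮⇒≥ λ r<lab → <⇒≱ (after (s≤s⁻¹ (<-≤-trans r<lab (lab≤ p)))) (below-lab r<lab)
      lower : ∀ r → r ≤ suc K → (∀ {j} → j < r → T j ≤ p) → r ≤ lab p
      lower zero    _     _      = z≤n
      lower (suc r) 1+r≤1+K before = Equivalence.from (lab-threshold (s≤s⁻¹ 1+r≤1+K)) (before ≤-refl)

    lab-mono : ∀ {p q} → p ≤ q → lab p ≤ lab q
    lab-mono {p} {q} p≤q = ≮⇒≥ λ labq<labp →
      <-irrefl refl (Equivalence.from (lab-threshold (s≤s⁻¹ (<-≤-trans labq<labp (lab≤ p))))
                                      (≤-trans (below-lab labq<labp) p≤q))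

    lab-first : ∀ {p} → p < T 0 → lab p ≡ 0
    lab-first p<T0 = lab-exact z≤n (λ ()) (λ _ → p<T0)

    lab-last : ∀ {p} → T K ≤ p → lab p ≡ suc K
    lab-last TK≤p = lab-exact ≤-refl (λ j<1+K → ≤-trans (T-mono (s≤s⁻¹ j<1+K) ≤-refl) TK≤p)
                            (λ 1+K≤K → contradiction 1+K≤K 1+n≰n)

    lab-T : ∀ {r} → r ≤ K → lab (T r) ≡ suc r
    lab-T r≤K = lab-exact (s≤s r≤K) (λ j<1+r → T-mono (s≤s⁻¹ j<1+r) r≤K) T-step

    0<T : ∀ {r} → r ≤ K → 0 < T r
    0<T r≤K = <-≤-trans 0<T0 (T-mono z≤n r≤K)

    lab-pred-T : ∀ {r} → r ≤ K → lab (pred (T r)) ≡ r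
    lab-pred-T {r} r≤K =
      lab-exact (m≤n⇒m≤1+n r≤K) (λ j<r → <⇒≤pred (T-strict j<r)) (λ _ → pred< (0<T r≤K))
      where
      pred< : ∀ {x} → 0 < x → pred x < x
      pred< (s≤s _) = ≤-refl
      T-strict : ∀ {j} → j < r → T j < T r
      T-strict j<r = <-≤-trans (T-step (<-≤-trans j<r r≤K)) (T-mono j<r r≤K)

    lab-onto : ∀ {r} → r < suc (suc K) → ∃ λ p → p < N × lab p ≡ r
    lab-onto {zero}  _         = 0 , s≤s z≤n , lab-first 0<T0
    lab-onto {suc r} 1+r<2+K = T r , ≤-<-trans (T-mono r≤K ≤-refl) TK<N , lab-T r≤K
      where
      r≤K : r ≤ K
      r≤K = s≤s⁻¹ (s≤s⁻¹ 1+r<2+K)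

    module Cyc = IntervalContraction lab (suc (suc K)) (λ {p} _ → s≤s (lab≤ p)) lab-mono lab-onto

    forward-edge : ∀ {p q} → p < q → p ~ q → lab p ≢ lab q → CycleEdge< K (lab p) (lab q)
    forward-edge {p} {q} p<q p~q lp≢lq with m≤n⇒m<n∨m≡n (lab-mono (<⇒≤ p<q))
    ... | inj₂ lp≡lq = contradiction lp≡lq lp≢lq
    ... | inj₁ lp<lq with m≤n⇒m<n∨m≡n lp<lq
    ...   | inj₂ 1+lp≡lq = inj₁ (sym 1+lp≡lq)
    ...   | inj₁ 2+lp≤lq =
            let (p<T0 , TK≤q) = long-edge lp<K (before-lab (<⇒≤ lp<K)) p~q (below-lab 2+lp≤lq)
            in inj₂ (lab-first p<T0 , lab-last TK≤q)
      where
      lp<K : lab p < K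
      lp<K = s≤s⁻¹ (≤-trans 2+lp≤lq (lab≤ q))

    H-Adj⇒cycle : ∀ a b → Cyc.H-Adj a b → CycleAdj (suc (suc K)) a b
    H-Adj⇒cycle a b h@(a≢b , _) with Cyc.H-Adj⇒~ h
    ... | p , q , p~q , lp , lq = Equivalence.from (cycleAdj⇔ a b) (edges (<-cmp p q))
      where
      lp≢lq : lab p ≢ lab q
      lp≢lq e = a≢b (toℕ-injective (trans (sym lp) (trans e lq)))
      edges : Tri (p < q) (p ≡ q) (q < p) → CycleEdge< K (toℕ a) (toℕ b) ⊎ CycleEdge< K (toℕ b) (toℕ a)
      edges (tri< p<q _ _) = inj₁ (subst₂ (CycleEdge< K) lp lq (forward-edge p<q p~q lp≢lq))
      edges (tri≈ _ p≡q _) = contradiction p≡q (~-irrefl p~q)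
      edges (tri> _ _ q<p) = inj₂ (subst₂ (CycleEdge< K) lq lp (forward-edge q<p (~-sym p~q) (λ e → lp≢lq (sym e))))

    cycle-edge⇒H-Adj : ∀ a b → CycleEdge< K (toℕ a) (toℕ b) → Cyc.H-Adj a b
    cycle-edge⇒H-Adj a b (inj₁ b≡1+a) = Cyc.~⇒H-Adj (edge-into (0<T a≤K) (≤-<-trans (T-mono a≤K ≤-refl) TK<N))
                                          (lab-pred-T a≤K) (trans (lab-T a≤K) (sym b≡1+a))
                                          λ a≡b → 1+n≢n (sym (trans (cong toℕ a≡b) b≡1+a))
      where
      a≤K : toℕ a ≤ K
      a≤K = s≤s⁻¹ (s≤s⁻¹ (subst (_< suc (suc K)) b≡1+a (toℕ<n b)))
      edge-into : ∀ {x} → 0 < x → x < N → pred x ~ x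
      edge-into {suc x} _ = path-edge
    cycle-edge⇒H-Adj a b (inj₂ (a≡0 , b≡1+K)) = Cyc.~⇒H-Adj wrap-edge
                                                 (trans (lab-first 0<T0) (sym a≡0))
                                                 (trans (lab-last (s≤s⁻¹ TK<N)) (sym b≡1+K))
                                                 λ a≡b → 0≢1+n (trans (sym a≡0) (trans (cong toℕ a≡b) b≡1+K))

    cycle⇒H-Adj : ∀ a b → CycleAdj (suc (suc K)) a b → Cyc.H-Adj a b
    cycle⇒H-Adj a b c with Equivalence.to (cycleAdj⇔ a b) c
    ... | inj₁ e = cycle-edge⇒H-Adj a b e
    ... | inj₂ e = Graph.sym Cyc.H (cycle-edge⇒H-Adj b a e)

  record Separators (s a len : ℕ) : Set where
    field
      t           : ℕ → ℕ
      t-range     : ∀ {i} → i < s → a ≤ t i × t i < a + len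
      t-step      : ∀ {i} → suc i < s → t i < t (suc i)
      t-separates : ∀ {i u v} → suc i < s → u < t i → u ~ v → t (suc i) ≤ v → ∀ {j} → j < s → t j ≤ v

  prepend : ∀ {s a b L len} → a < b → b + L ≤ a + len →
            (∀ y → b ≤ y → y < b + L → ¬ PrefixNeighbour a y) →
            Separators s b L → Separators (suc s) a len
  prepend {s} {a} {b} {L} {len} a<b b+L≤a+len gap seps = record
    { t = t′ ; t-range = t′-range ; t-step = t′-step ; t-separates = t′-separates }
    where
    open Separators seps
    t′ : ℕ → ℕ
    t′ zero    = a
    t′ (suc i) = t i
    b≤t : ∀ {i} → i < s → b ≤ t i
    b≤t i<s = proj₁ (t-range i<s)
    t<b+L : ∀ {i} → i < s → t i < b + L
    t<b+L i<s = proj₂ (t-range i<s)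
    t′-range : ∀ {i} → i < suc s → a ≤ t′ i × t′ i < a + len
    t′-range {zero}  _          = ≤-refl , <-≤-trans (<-≤-trans a<b (m≤m+n b L)) b+L≤a+len
    t′-range {suc i} (s≤s i<s) = ≤-trans (<⇒≤ a<b) (b≤t i<s) , <-≤-trans (t<b+L i<s) b+L≤a+len
    t′-step : ∀ {i} → suc i < suc s → t′ i < t′ (suc i)
    t′-step {zero}  (s≤s 0<s)   = <-≤-trans a<b (b≤t 0<s)
    t′-step {suc i} (s≤s 1+i<s) = t-step 1+i<s
    t′-separates : ∀ {i u v} → suc i < suc s → u < t′ i → u ~ v → t′ (suc i) ≤ v →
                   ∀ {j} → j < suc s → t′ j ≤ v
    t′-separates {zero} {u} {v} (s≤s 0<s) u<a u~v t0≤v {j} j<1+s = below j j<1+s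
      where
      b≤v : b ≤ v
      b≤v = ≤-trans (b≤t 0<s) t0≤v
      b+L≤v : b + L ≤ v
      b+L≤v = ≮⇒≥ λ v<b+L → gap v b≤v v<b+L (≤-trans (<⇒≤ a<b) b≤v , u , u<a , u~v)
      below : ∀ j → j < suc s → t′ j ≤ v
      below zero    _         = ≤-trans (<⇒≤ a<b) b≤v
      below (suc j) (s≤s j<s) = ≤-trans (<⇒≤ (t<b+L j<s)) b+L≤v
    t′-separates {suc i} (s≤s 1+i<s) u<t u~v t≤v {zero}  _          =
      ≤-trans (<⇒≤ a<b) (≤-trans (b≤t 0<s) (t-separates 1+i<s u<t u~v t≤v 0<s))
      where
      0<s : 0 < s
      0<s = <-trans z<s 1+i<s
    t′-separates {suc i} (s≤s 1+i<s) u<t u~v t≤v {suc j} (s≤s j<s) = t-separates 1+i<s u<t u~v t≤v j<s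

  prefix-star-or-separators : ∀ d s a len → separationLength d s ≤ len → 1 ≤ a → a + len ≤ N →
    Contraction (λ _ → HasDegreeAtLeast d) ⊎ Separators s a len
  prefix-star-or-separators d zero a len _ _ _ =
    inj₂ record { t = λ _ → 0 ; t-range = λ () ; t-step = λ () ; t-separates = λ () }
  prefix-star-or-separators d (suc s) a len L′≤len 1≤a a+len≤N
    with atLeast-or-gap (PrefixNeighbour a) (PrefixNeighbour? a) (λ y → y) (separationLength d s) d (suc a)
  ... | inj₁ nbs = inj₁ (prefix-star 1≤a (≤-trans (m≤m+n a len) a+len≤N) (AtLeast-map proj₂ nbs))
  ... | inj₂ (b , a<b , b+L≤ , gap) =
        map₂ (prepend a<b b+L≤a+len gap)
             (prefix-star-or-separators d s b L ≤-refl (≤-trans (s≤s z≤n) a<b) (≤-trans b+L≤a+len a+len≤N))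
    where
    L : ℕ
    L = separationLength d s
    b+L≤a+len : b + L ≤ a + len
    b+L≤a+len = ≤-trans b+L≤ (subst (_≤ a + len) (+-suc a (d * L)) (+-monoʳ-≤ a L′≤len))

  gap⇒cycle : ∀ {d K} (seps : Separators (suc (d * K)) 1 n) (let t = Separators.t seps) {b} → b + K ≤ d * K →
              (∀ y → t b ≤ y → y < t (b + K) → ¬ SuffixNeighbour (t (d * K)) y) →
              Contraction (λ _ → IsoToCycle (suc (suc K)))
  gap⇒cycle {d} {K} seps {b} b+K≤dK gap = cycle-contraction K T T-step 0<T0 TK<N long-edge
    where
    open Separators seps
    T : ℕ → ℕ
    T j = t (b + j)
    t-mono : ∀ {i j} → i ≤ j → j ≤ d * K → t i ≤ t j
    t-mono = steps-mono (λ j<dK → t-step (s≤s j<dK))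
    b+j≤dK : ∀ {j} → j ≤ K → b + j ≤ d * K
    b+j≤dK j≤K = ≤-trans (+-monoʳ-≤ b j≤K) b+K≤dK
    1+b+j≤dK : ∀ {j} → j < K → suc (b + j) ≤ d * K
    1+b+j≤dK {j} j<K = subst (_≤ d * K) (+-suc b j) (b+j≤dK j<K)
    T-step : ∀ {j} → j < K → T j < T (suc j)
    T-step {j} j<K = subst (λ i → t (b + j) < t i) (sym (+-suc b j)) (t-step (s≤s (1+b+j≤dK j<K)))
    0<T0 : 0 < T 0
    0<T0 = proj₁ (t-range (s≤s (b+j≤dK z≤n)))
    TK<N : T K < N
    TK<N = proj₂ (t-range (s≤s (b+j≤dK ≤-refl)))
    long-edge : ∀ {j u v} → j < K → u < T j → u ~ v → T (suc j) ≤ v → u < T 0 × T K ≤ v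
    long-edge {j} {u} {v} j<K u<Tj u~v T1+j≤v = u<T0 , beyond (s≤s (b+j≤dK ≤-refl))
      where
      beyond : ∀ {i} → i < suc (d * K) → t i ≤ v
      beyond = t-separates (s≤s (1+b+j≤dK j<K)) u<Tj u~v (subst (λ i → t i ≤ v) (+-suc b j) T1+j≤v)
      u<t[b+K] : u < t (b + K)
      u<t[b+K] = <-≤-trans u<Tj (t-mono (+-monoʳ-≤ b (<⇒≤ j<K)) b+K≤dK)
      u<T0 : u < T 0
      u<T0 = ≰⇒> λ T0≤u → gap u (subst (λ i → t i ≤ u) (+-identityʳ b) T0≤u) u<t[b+K]
               (<-≤-trans u<t[b+K] (t-mono b+K≤dK ≤-refl) , v , beyond ≤-refl , u~v)

  suffix-star-or-cycle : ∀ d K → Separators (suc (d * K)) 1 n →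
    Contraction (λ _ H → HasDegreeAtLeast d H ⊎ IsoToCycle (suc (suc K)) H)
  suffix-star-or-cycle d K seps =
    [ (λ nbs → contraction-map inj₁ (suffix-star (proj₂ (t-range ≤-refl)) (AtLeast-map proj₂ nbs)))
    , (λ (b , _ , b+K≤dK , gap) → contraction-map inj₂ (gap⇒cycle {d} seps b+K≤dK gap)) ]′
    (atLeast-or-gap (SuffixNeighbour (t (d * K))) (SuffixNeighbour? (t (d * K))) t K d 0)
    where open Separators seps

  degree-or-cycle : ∀ d K → separationLength d (suc (d * K)) ≤ n →
    Contraction (λ _ H → HasDegreeAtLeast d H ⊎ IsoToCycle (suc (suc K)) H)
  degree-or-cycle d K L≤n = [ contraction-map inj₁ , suffix-star-or-cycle d K ]′
                              (prefix-star-or-separators d (suc (d * K)) 1 n L≤n ≤-refl ≤-refl)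

lemma4p2 : Σ (ℕ → ℕ → ℕ) λ f → ∀ (k d : ℕ) → 2 < k → 2 < d →
             ∀ (n : ℕ) (G : Graph (suc n)) (C : HamCycle G) → f k d ≤ suc n →
             ∃ λ (X : EdgeSet (suc n)) → ∃ λ (m : ℕ) → ∃ λ (H : Graph m) →
               IsContraction C X H × (HasDegreeAtLeast d H ⊎ IsoToCycle k H)
lemma4p2 = f , proof
  where
  f : ℕ → ℕ → ℕ
  f k d = suc (separationLength d (suc (d * (k ∸ 2))))
  proof : ∀ k d → 2 < k → 2 < d → ∀ n (G : Graph (suc n)) (C : HamCycle G) → f k d ≤ suc n →
          AlongCycle.Contraction G C (λ _ H → HasDegreeAtLeast d H ⊎ IsoToCycle k H)
  proof (suc zero)    d (s≤s ())
  proof (suc (suc K)) d _ _ n G C (s≤s L≤n) = AlongCycle.degree-or-cycle G C d K L≤n
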